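{- The coproduct, computed in the category $\mathsf{u\ell g}$ of unital $\ell$-groups and unital $\ell$-homomorphisms, of an infinite family $(S_i,u_i)_{i\in I}$ of unital Specker $\ell$-groups need not be a unital Specker $\ell$-group, even when there is a fixed $n\in\mathbb Z_{>0}$ such that all the functions $u_i^\natural$ take values bounded by $n$.
   Context: An $\ell$-group is a lattice-ordered abelian group. A unit of $G$ is $u\ge0$ such that each $g\in G$ satisfies $|g|\le nu$ for some $n\in\mathbb Z_{>0}$; $(G,u)$ is a unital $\ell$-group, and unital $\ell$-homomorphisms are $\ell$-homomorphisms preserving units; the category $\mathsf{u\ell g}$ has all coproducts. A singular element is $s\ge0$ with $a\wedge(s-a)=0$ for all $0\le a\le s$; a Specker $\ell$-group is generated as a group by its singular elements; a unital Specker $\ell$-group is $(S,u)$ with $S$ Specker and $u$ a unit. An ideal is a proper convex $\ell$-subgroup; $\operatorname{MaxSpec}(S)$ is the set of maximal ideals. For a unital Specker $\ell$-group $(S,u)$ and $\mathfrak m\in\operatorname{MaxSpec}(S)$ there is a unique surjective $\ell$-homomorphism $\rho_{\mathfrak m}\colon S\to\mathbb Z$ with kernel $\mathfrak m$, and $u^\natural\colon\operatorname{MaxSpec}(S)\to\mathbb Z$ is $\mathfrak m\mapsto\rho_{\mathfrak m}(u)$. -}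

module Defs where

open import Level using (0ℓ)
open import Data.Nat using (ℕ; zero; suc)
open import Data.Integer as ℤ using (ℤ; +_)
import Data.Integer.Properties as ℤP
open import Data.List using (List; []; _∷_)
open import Data.List.Relation.Unary.All using (All)
open import Data.Product using (Σ; _×_; _,_; ∃)
open import Data.Empty using (⊥)
open import Relation.Nullary using (¬_)
open import Relation.Binary.PropositionalEquality using (_≡_)
open import Algebra.Core using (Op₁; Op₂)
open import Algebra.Structures using (IsAbelianGroup)
open import Algebra.Lattice.Structures using (IsLattice)

record LGroup : Set₁ where
  infixl 6 _+_ _-_
  infixr 7 _∧_
  infixr 6 _∨_
  infix 4 _≈_ _≤_
  field
    Carrier        : Set
    _≈_            : Carrier → Carrier → Set
    _+_            : Op₂ Carrier
    0#             : Carrier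
    -_             : Op₁ Carrier
    _∨_            : Op₂ Carrier
    _∧_            : Op₂ Carrier
    isAbelianGroup : IsAbelianGroup _≈_ _+_ 0# -_
    isLattice      : IsLattice _≈_ _∨_ _∧_
    +-distrib-∨    : ∀ a b c → (a ∨ b) + c ≈ (a + c) ∨ (b + c)

  _-_ : Op₂ Carrier
  a - b = a + (- b)

  _≤_ : Carrier → Carrier → Set
  a ≤ b = a ∧ b ≈ a

  ∣_∣ : Carrier → Carrier
  ∣ g ∣ = g ∨ (- g)

  _·_ : ℕ → Carrier → Carrier
  zero  · g = 0#
  suc n · g = g + (n · g)

  sum : List Carrier → Carrier
  sum []       = 0#
  sum (x ∷ xs) = x + sum xs

  IsUnit : Carrier → Set
  IsUnit u = (0# ≤ u) × (∀ g → ∃ λ n → ∣ g ∣ ≤ (suc n · u))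

  Singular : Carrier → Set
  Singular s = (0# ≤ s) × (∀ a → 0# ≤ a → a ≤ s → a ∧ (s - a) ≈ 0#)

  -- Specker: generated as a group by the singular elements, i.e. every
  -- element is a difference of two finite sums of singular elements.
  IsSpecker : Set
  IsSpecker = ∀ g → Σ (List Carrier) λ ss → Σ (List Carrier) λ ts →
                All Singular ss × All Singular ts × (g ≈ sum ss - sum ts)

  record IsIdeal (P : Carrier → Set) : Set where
    field
      resp   : ∀ {a b} → a ≈ b → P a → P b
      zero∈  : P 0#
      +-cl   : ∀ {a b} → P a → P b → P (a + b)
      neg-cl : ∀ {a} → P a → P (- a)
      ∧-cl   : ∀ {a b} → P a → P b → P (a ∧ b)
      ∨-cl   : ∀ {a b} → P a → P b → P (a ∨ b)
      convex : ∀ {a b x} → P a → P b → a ≤ x → x ≤ b → P x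
      proper : ∃ λ g → ¬ P g

  record IsMaximalIdeal (P : Carrier → Set) : Set₁ where
    field
      isIdeal : IsIdeal P
      maximal : ∀ Q → IsIdeal Q → (∀ {a} → P a → Q a) → ∀ {a} → Q a → P a

open LGroup public using (Carrier)

record IsLHom (G H : LGroup) (f : Carrier G → Carrier H) : Set where
  private
    module G = LGroup G
    module H = LGroup H
  field
    cong   : ∀ {a b} → a G.≈ b → f a H.≈ f b
    hom-+  : ∀ a b → f (a G.+ b) H.≈ (f a H.+ f b)
    hom-∧  : ∀ a b → f (a G.∧ b) H.≈ (f a H.∧ f b)
    hom-∨  : ∀ a b → f (a G.∨ b) H.≈ (f a H.∨ f b)

ℤ-LGroup : LGroup
ℤ-LGroup = record
  { Carrier        = ℤ
  ; _≈_            = _≡_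
  ; _+_            = ℤ._+_
  ; 0#             = + 0
  ; -_             = ℤ.-_
  ; _∨_            = ℤ._⊔_
  ; _∧_            = ℤ._⊓_
  ; isAbelianGroup = ℤP.+-0-isAbelianGroup
  ; isLattice      = ℤP.⊔-⊓-isLattice
  ; +-distrib-∨    = λ a b c → ℤP.mono-≤-distrib-⊔ (ℤP.+-monoˡ-≤ c) a b
  }

record UnitalLGroup : Set₁ where
  field
    group  : LGroup
    unit   : Carrier group
    isUnit : LGroup.IsUnit group unit
  open LGroup group public

record UHom (G H : UnitalLGroup) : Set where
  private
    module G = UnitalLGroup G
    module H = UnitalLGroup H
  field
    fun     : G.Carrier → H.Carrier
    isLHom  : IsLHom G.group H.group fun
    unital  : fun G.unit H.≈ H.unit

_∘U_ : ∀ {G H K} → UHom H K → UHom G H → G .UnitalLGroup.Carrier → K .UnitalLGroup.Carrier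
(g ∘U f) x = UHom.fun g (UHom.fun f x)

_≗U_ : ∀ {G H} → (f g : UHom G H) → Set
_≗U_ {G} {H} f g = ∀ x → UnitalLGroup._≈_ H (UHom.fun f x) (UHom.fun g x)

record IsCoproduct {I : Set} (S : I → UnitalLGroup)
                   (C : UnitalLGroup) (ι : ∀ i → UHom (S i) C) : Set₁ where
  field
    mediate : ∀ (H : UnitalLGroup) (f : ∀ i → UHom (S i) H) →
              Σ (UHom C H) λ h → ∀ i x →
                UnitalLGroup._≈_ H (UHom.fun h (UHom.fun (ι i) x)) (UHom.fun (f i) x)
    unique  : ∀ (H : UnitalLGroup) (h h' : UHom C H) →
              (∀ i x → UnitalLGroup._≈_ H (UHom.fun h  (UHom.fun (ι i) x))
                                          (UHom.fun h' (UHom.fun (ι i) x))) →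
              h ≗U h'

-- Unital Specker ℓ-groups and the bound on u♮.
-- u♮(𝔪) = ρ_𝔪(u), where ρ_𝔪 : S → ℤ is the (unique) surjective
-- ℓ-homomorphism with kernel 𝔪.  "u♮ takes values bounded by n" is
-- stated as: for every maximal ideal 𝔪 and every surjective
-- ℓ-homomorphism ρ : S → ℤ with kernel 𝔪, ρ(u) ≤ n.

IsUnitalSpecker : UnitalLGroup → Set
IsUnitalSpecker S = UnitalLGroup.IsSpecker S

UNaturalBoundedBy : UnitalLGroup → ℕ → Set₁
UNaturalBoundedBy S n =
  ∀ (𝔪 : Carrier G → Set) → LGroup.IsMaximalIdeal G 𝔪 →
  ∀ (ρ : Carrier G → ℤ) → IsLHom G ℤ-LGroup ρ →
  (∀ z → ∃ λ g → ρ g ≡ z) →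
  (∀ g → (ρ g ≡ + 0 → 𝔪 g) × (𝔪 g → ρ g ≡ + 0)) →
  ρ (UnitalLGroup.unit S) ℤ.≤ + n
  where G = UnitalLGroup.group S

-- ℤ² with unit (1,2) is Specker, being generated by the singular elements (1,0) and (0,1),
-- and its only surjective ℓ-homomorphisms onto ℤ are the two projections, so u♮ ≤ 2.
-- Let C be the coproduct of countably many copies, presented by generators and relations.
-- Sending every copy to ℤ by (x,y) ↦ 2x evaluates the unit of C to 2 and every element to an
-- even integer.  A singular s involves only finitely many copies; sending one further copy
-- k to ℤ by (x,y) ↦ y instead does not change the value of s, and testing singularity of s
-- against s ∧ (0,1)ₖ then forces that value to be at most 1, hence 0.  So every sum of
-- singular elements evaluates to 0, the unit does not, and C is not Specker.

module Submission where

open import Level using (0ℓ)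
open import Data.Empty using (⊥-elim)
open import Data.Nat as ℕ using (ℕ; zero; suc; z≤n; s≤s; NonZero)
import Data.Nat.Properties as ℕP
open import Data.Integer as ℤ using (ℤ; +_; -[1+_]; +≤+; -≤+)
import Data.Integer.Properties as ℤP
open import Data.Product using (Σ; _×_; _,_; proj₁; proj₂; ∃; ∃₂; zip; map)
open import Data.Product.Relation.Binary.Pointwise.NonDependent using (Pointwise; ×-isEquivalence)
open import Data.Sum using (_⊎_; inj₁; inj₂)
open import Data.List using (List; []; _∷_; _++_)
open import Data.List.Relation.Unary.All as All using (All; []; _∷_)
import Data.List.Relation.Unary.All.Properties as Allₚ
open import Data.List.Extrema.Nat using (max; xs≤max)
open import Function.Bundles using (_↣_)
open import Function.Construct.Identity using (↣-id)
open import Relation.Nullary using (¬_; yes; no)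
open import Relation.Binary.PropositionalEquality
  using (_≡_; _≢_; refl; sym; trans; cong; cong₂; subst; subst₂; module ≡-Reasoning)
open import Relation.Binary.Structures using (IsEquivalence)
import Relation.Binary.Lattice.Bundles as OrderTheoretic
import Relation.Binary.Reasoning.PartialOrder as ≤-Reasoning
open import Algebra.Bundles using (AbelianGroup)
open import Algebra.Lattice.Bundles using (Lattice)
import Algebra.Construct.DirectProduct as DirectProduct
import Algebra.Properties.Group as GroupProperties
import Algebra.Lattice.Properties.Lattice as LatticeProperties

open import Defs hiding (Carrier)

-- Order, multiples and bounds in an ℓ-group

module LGroupProperties (G : LGroup) where
  open LGroup G public hiding (_≤_)
  open LGroup G using () renaming (_≤_ to _≤ᴰ_)

  abelianGroup : AbelianGroup 0ℓ 0ℓ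
  abelianGroup = record { isAbelianGroup = isAbelianGroup }

  lattice : Lattice 0ℓ 0ℓ
  lattice = record { isLattice = isLattice }

  open AbelianGroup abelianGroup public
    using (isEquivalence; assoc; comm; identityˡ; identityʳ; inverseˡ; inverseʳ; ∙-cong; ⁻¹-cong)
    renaming (refl to ≈-refl; sym to ≈-sym; trans to ≈-trans)
  open GroupProperties (AbelianGroup.group abelianGroup) public
    using (⁻¹-involutive; ε⁻¹≈ε; identityˡ-unique; inverseˡ-unique; ⁻¹-anti-homo-∙; \\-leftDividesˡ)
  open Lattice lattice public
    using (∨-comm; ∨-assoc; ∨-cong; ∧-comm; ∧-assoc; ∧-cong; ∨-absorbs-∧; ∧-absorbs-∨)
  open LatticeProperties lattice public using (∧-idem; ∨-idem; ∨-∧-orderTheoreticLattice)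
  open OrderTheoretic.Lattice ∨-∧-orderTheoreticLattice public
    using (_≤_; poset; x≤x∨y; y≤x∨y; ∨-least; x∧y≤x; ∧-greatest; ≤-respʳ-≈; ≤-respˡ-≈)
    renaming (refl to ≤-refl; trans to ≤-trans; antisym to ≤-antisym; reflexive to ≤-reflexive)

  -- Defs orders by  a ∧ b ≈ a,  the library lattice by  a ≈ a ∧ b.
  ≤ᴰ⇒≤ : ∀ {a b} → a ≤ᴰ b → a ≤ b
  ≤ᴰ⇒≤ = ≈-sym

  ≤⇒≤ᴰ : ∀ {a b} → a ≤ b → a ≤ᴰ b
  ≤⇒≤ᴰ = ≈-sym

  ≤⇒∨≈ : ∀ {a b} → a ≤ b → a ∨ b ≈ b
  ≤⇒∨≈ {a} {b} a≤b = ≤-antisym (∨-least a≤b ≤-refl) (y≤x∨y a b)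

  +-monoˡ-≤ : ∀ {a b} c → a ≤ b → a + c ≤ b + c
  +-monoˡ-≤ {a} {b} c a≤b =
    ≤-respʳ-≈ (≈-trans (≈-sym (+-distrib-∨ a b c)) (∙-cong (≤⇒∨≈ a≤b) ≈-refl)) (x≤x∨y (a + c) (b + c))

  +-mono-≤ : ∀ {a b c d} → a ≤ b → c ≤ d → a + c ≤ b + d
  +-mono-≤ {a} {b} {c} {d} a≤b c≤d = begin
    a + c  ≤⟨ +-monoˡ-≤ c a≤b ⟩
    b + c  ≈⟨ comm b c ⟩
    c + b  ≤⟨ +-monoˡ-≤ b c≤d ⟩
    d + b  ≈⟨ comm d b ⟩
    b + d  ∎
    where open ≤-Reasoning poset

  neg-antimono-≤ : ∀ {a b} → a ≤ b → - b ≤ - a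
  neg-antimono-≤ {a} {b} a≤b = begin
    - b              ≈⟨ ≈-sym (\\-leftDividesˡ a (- b)) ⟩
    a + (- a + - b)  ≤⟨ +-monoˡ-≤ (- a + - b) a≤b ⟩
    b + (- a + - b)  ≈⟨ ∙-cong ≈-refl (comm (- a) (- b)) ⟩
    b + (- b + - a)  ≈⟨ \\-leftDividesˡ b (- a) ⟩
    - a              ∎
    where open ≤-Reasoning poset

  ·-cong : ∀ n {a b} → a ≈ b → n · a ≈ n · b
  ·-cong zero    a≈b = ≈-refl
  ·-cong (suc n) a≈b = ∙-cong a≈b (·-cong n a≈b)

  ·-distribʳ-+ : ∀ m n a → (m ℕ.+ n) · a ≈ m · a + n · a
  ·-distribʳ-+ zero    n a = ≈-sym (identityˡ (n · a))
  ·-distribʳ-+ (suc m) n a =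
    ≈-trans (∙-cong ≈-refl (·-distribʳ-+ m n a)) (≈-sym (assoc a (m · a) (n · a)))

  record Bounded (u : Carrier) (N : ℕ) (g : Carrier) : Set where
    constructor bounded
    field
      lower : - (N · u) ≤ g
      upper : g ≤ N · u

  Bounded⇒∣∣≤ : ∀ {u N g} → Bounded u N g → ∣ g ∣ ≤ N · u
  Bounded⇒∣∣≤ (bounded lo hi) = ∨-least hi (≤-respʳ-≈ (⁻¹-involutive _) (neg-antimono-≤ lo))

  ∣∣≤⇒Bounded : ∀ {u N g} → ∣ g ∣ ≤ N · u → Bounded u N g
  ∣∣≤⇒Bounded {g = g} ∣g∣≤ = bounded
    (≤-respʳ-≈ (⁻¹-involutive g) (neg-antimono-≤ (≤-trans (y≤x∨y g (- g)) ∣g∣≤)))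
    (≤-trans (x≤x∨y g (- g)) ∣g∣≤)

  Bounded-neg : ∀ {u N g} → Bounded u N g → Bounded u N (- g)
  Bounded-neg (bounded lo hi) = bounded (neg-antimono-≤ hi) (≤-respʳ-≈ (⁻¹-involutive _) (neg-antimono-≤ lo))

  Bounded-unit-cong : ∀ {u v N g} → u ≈ v → Bounded u N g → Bounded v N g
  Bounded-unit-cong {N = N} u≈v (bounded lo hi) =
    bounded (≤-respˡ-≈ (⁻¹-cong (·-cong N u≈v)) lo) (≤-respʳ-≈ (·-cong N u≈v) hi)

  module _ {u : Carrier} (0≤u : 0# ≤ u) where

    ·-monoˡ-≤ : ∀ {m n} → m ℕ.≤ n → m · u ≤ n · u
    ·-monoˡ-≤ {n = zero}  z≤n       = ≤-refl
    ·-monoˡ-≤ {n = suc n} z≤n       =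
      ≤-respˡ-≈ (identityˡ 0#) (+-mono-≤ 0≤u (·-monoˡ-≤ {n = n} z≤n))
    ·-monoˡ-≤             (s≤s m≤n) = +-mono-≤ ≤-refl (·-monoˡ-≤ m≤n)

    Bounded-0# : Bounded u 0 0#
    Bounded-0# = bounded (≤-reflexive ε⁻¹≈ε) ≤-refl

    Bounded-mono : ∀ {M N g} → M ℕ.≤ N → Bounded u M g → Bounded u N g
    Bounded-mono M≤N (bounded lo hi) =
      bounded (≤-trans (neg-antimono-≤ (·-monoˡ-≤ M≤N)) lo) (≤-trans hi (·-monoˡ-≤ M≤N))

    Bounded-+ : ∀ {M N a b} → Bounded u M a → Bounded u N b → Bounded u (M ℕ.+ N) (a + b)
    Bounded-+ {M} {N} {a} {b} (bounded loa hia) (bounded lob hib) =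
      bounded lo (≤-respʳ-≈ (≈-sym (·-distribʳ-+ M N u)) (+-mono-≤ hia hib))
      where
      open ≤-Reasoning poset
      lo : - ((M ℕ.+ N) · u) ≤ a + b
      lo = begin
        - ((M ℕ.+ N) · u)      ≈⟨ ⁻¹-cong (·-distribʳ-+ M N u) ⟩
        - (M · u + N · u)      ≈⟨ ⁻¹-anti-homo-∙ (M · u) (N · u) ⟩
        - (N · u) + - (M · u)  ≈⟨ comm _ _ ⟩
        - (M · u) + - (N · u)  ≤⟨ +-mono-≤ loa lob ⟩
        a + b                  ∎

    Bounded-∨ : ∀ {M N a b} → Bounded u M a → Bounded u N b → Bounded u (M ℕ.+ N) (a ∨ b)
    Bounded-∨ {M} {N} {a} {b} ba bb
      with Bounded-mono (ℕP.m≤m+n M N) ba | Bounded-mono (ℕP.m≤n+m N M) bb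
    ... | bounded loa hia | bounded _ hib = bounded (≤-trans loa (x≤x∨y a b)) (∨-least hia hib)

    Bounded-∧ : ∀ {M N a b} → Bounded u M a → Bounded u N b → Bounded u (M ℕ.+ N) (a ∧ b)
    Bounded-∧ {M} {N} {a} {b} ba bb
      with Bounded-mono (ℕP.m≤m+n M N) ba | Bounded-mono (ℕP.m≤n+m N M) bb
    ... | bounded loa hia | bounded lob _ = bounded (∧-greatest loa lob) (≤-trans (x∧y≤x a b) hia)

    bounded⇒isUnit : (∀ g → ∃ λ N → Bounded u N g) → IsUnit u
    bounded⇒isUnit all-bounded = ≤⇒≤ᴰ 0≤u , λ g →
      let N , bg = all-bounded g in
      N , ≤⇒≤ᴰ (≤-trans (Bounded⇒∣∣≤ bg) (·-monoˡ-≤ (ℕP.n≤1+n N)))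

  isUnit⇒bounded : ∀ {u} → IsUnit u → ∀ g → ∃ λ N → Bounded u N g
  isUnit⇒bounded (_ , unit) g = let n , ∣g∣≤ = unit g in suc n , ∣∣≤⇒Bounded (≤ᴰ⇒≤ ∣g∣≤)

-- Homomorphisms and products

module IsLHomProperties {G H : LGroup} {f : LGroup.Carrier G → LGroup.Carrier H}
                        (isLHom : IsLHom G H f) where
  private
    module G = LGroupProperties G
    module H = LGroupProperties H
  open IsLHom isLHom renaming (cong to f-cong)

  f-0# : f G.0# H.≈ H.0#
  f-0# = H.identityˡ-unique (f G.0#) (f G.0#)
           (H.≈-trans (H.≈-sym (hom-+ G.0# G.0#)) (f-cong (G.identityˡ G.0#)))

  f-neg : ∀ a → f (G.- a) H.≈ H.- f a
  f-neg a = H.inverseˡ-unique _ _ (H.≈-trans (H.≈-sym (hom-+ (G.- a) a)) (H.≈-trans (f-cong (G.inverseˡ a)) f-0#))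

  f-· : ∀ n a → f (n G.· a) H.≈ n H.· f a
  f-· zero    a = f-0#
  f-· (suc n) a = H.≈-trans (hom-+ a (n G.· a)) (H.∙-cong H.≈-refl (f-· n a))

  f-mono : ∀ {a b} → a G.≤ b → f a H.≤ f b
  f-mono {a} {b} a≤b = H.≈-trans (f-cong a≤b) (hom-∧ a b)

  f-Bounded : ∀ {u N g} → G.Bounded u N g → H.Bounded (f u) N (f g)
  f-Bounded {u} {N} (G.bounded lo hi) = H.bounded
    (H.≤-respˡ-≈ (H.≈-trans (f-neg (N G.· u)) (H.⁻¹-cong (f-· N u))) (f-mono lo))
    (H.≤-respʳ-≈ (f-· N u) (f-mono hi))

∘-isLHom : ∀ {G H K f g} → IsLHom H K g → IsLHom G H f → IsLHom G K (λ x → g (f x))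
∘-isLHom {K = K} {f} {g} isLHom-g isLHom-f = record
  { cong  = λ a≈b → G.cong (F.cong a≈b)
  ; hom-+ = λ a b → ≈-trans (G.cong (F.hom-+ a b)) (G.hom-+ (f a) (f b))
  ; hom-∧ = λ a b → ≈-trans (G.cong (F.hom-∧ a b)) (G.hom-∧ (f a) (f b))
  ; hom-∨ = λ a b → ≈-trans (G.cong (F.hom-∨ a b)) (G.hom-∨ (f a) (f b))
  }
  where
  module F = IsLHom isLHom-f
  module G = IsLHom isLHom-g
  open LGroupProperties K using (≈-trans)

_∘ᵘ_ : ∀ {G H K} → UHom H K → UHom G H → UHom G K
_∘ᵘ_ {K = K} g f = record
  { fun    = g ∘U f
  ; isLHom = ∘-isLHom (UHom.isLHom g) (UHom.isLHom f)
  ; unital = LGroupProperties.≈-trans (UnitalLGroup.group K)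
               (IsLHom.cong (UHom.isLHom g) (UHom.unital f)) (UHom.unital g)
  }

_×ᴸ_ : LGroup → LGroup → LGroup
G ×ᴸ H = record
  { Carrier        = G.Carrier × H.Carrier
  ; _≈_            = Pointwise G._≈_ H._≈_
  ; _+_            = zip G._+_ H._+_
  ; 0#             = G.0# , H.0#
  ; -_             = map (G.-_) (H.-_)
  ; _∨_            = zip G._∨_ H._∨_
  ; _∧_            = zip G._∧_ H._∧_
  ; isAbelianGroup = AbelianGroup.isAbelianGroup (DirectProduct.abelianGroup G.abelianGroup H.abelianGroup)
  ; isLattice      = record
    { isEquivalence = ×-isEquivalence G.isEquivalence H.isEquivalence
    ; ∨-comm        = λ (a , b) (c , d) → G.∨-comm a c , H.∨-comm b d
    ; ∨-assoc       = λ (a , b) (c , d) (e , f) → G.∨-assoc a c e , H.∨-assoc b d f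
    ; ∨-cong        = λ (p , q) (r , s) → G.∨-cong p r , H.∨-cong q s
    ; ∧-comm        = λ (a , b) (c , d) → G.∧-comm a c , H.∧-comm b d
    ; ∧-assoc       = λ (a , b) (c , d) (e , f) → G.∧-assoc a c e , H.∧-assoc b d f
    ; ∧-cong        = λ (p , q) (r , s) → G.∧-cong p r , H.∧-cong q s
    ; absorptive    = (λ (a , b) (c , d) → G.∨-absorbs-∧ a c , H.∨-absorbs-∧ b d)
                    , (λ (a , b) (c , d) → G.∧-absorbs-∨ a c , H.∧-absorbs-∨ b d)
    }
  ; +-distrib-∨    = λ (a , b) (c , d) (e , f) → G.+-distrib-∨ a c e , H.+-distrib-∨ b d f
  }
  where
  module G = LGroupProperties G
  module H = LGroupProperties H

module ×ᴸ-Properties (G H : LGroup) where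
  private
    module G = LGroupProperties G
    module H = LGroupProperties H
    module GH = LGroupProperties (G ×ᴸ H)

  proj₁-isLHom : IsLHom (G ×ᴸ H) G proj₁
  proj₁-isLHom = record
    { cong = proj₁ ; hom-+ = λ _ _ → G.≈-refl ; hom-∧ = λ _ _ → G.≈-refl ; hom-∨ = λ _ _ → G.≈-refl }

  proj₂-isLHom : IsLHom (G ×ᴸ H) H proj₂
  proj₂-isLHom = record
    { cong = proj₂ ; hom-+ = λ _ _ → H.≈-refl ; hom-∧ = λ _ _ → H.≈-refl ; hom-∨ = λ _ _ → H.≈-refl }

  inj₁-isLHom : IsLHom G (G ×ᴸ H) (_, H.0#)
  inj₁-isLHom = record
    { cong  = _, H.≈-refl
    ; hom-+ = λ _ _ → G.≈-refl , H.≈-sym (H.identityˡ H.0#)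
    ; hom-∧ = λ _ _ → G.≈-refl , H.≈-sym (H.∧-idem H.0#)
    ; hom-∨ = λ _ _ → G.≈-refl , H.≈-sym (H.∨-idem H.0#)
    }

  inj₂-isLHom : IsLHom H (G ×ᴸ H) (G.0# ,_)
  inj₂-isLHom = record
    { cong  = G.≈-refl ,_
    ; hom-+ = λ _ _ → G.≈-sym (G.identityˡ G.0#) , H.≈-refl
    ; hom-∧ = λ _ _ → G.≈-sym (G.∧-idem G.0#) , H.≈-refl
    ; hom-∨ = λ _ _ → G.≈-sym (G.∨-idem G.0#) , H.≈-refl
    }

  ·-× : ∀ n u v → n GH.· (u , v) GH.≈ (n G.· u , n H.· v)
  ·-× zero    u v = G.≈-refl , H.≈-refl
  ·-× (suc n) u v = let p , q = ·-× n u v in G.∙-cong G.≈-refl p , H.∙-cong H.≈-refl q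

  Bounded-× : ∀ {u v N g h} → G.Bounded u N g → H.Bounded v N h → GH.Bounded (u , v) N (g , h)
  Bounded-× {u} {v} {N} (G.bounded lo₁ hi₁) (H.bounded lo₂ hi₂) = GH.bounded
    (GH.≤-respˡ-≈ (GH.⁻¹-cong (GH.≈-sym (·-× N u v))) (lo₁ , lo₂))
    (GH.≤-respʳ-≈ (GH.≈-sym (·-× N u v)) (hi₁ , hi₂))

  isUnit-× : ∀ {u v} → G.IsUnit u → H.IsUnit v → GH.IsUnit (u , v)
  isUnit-× {u} {v} unit-u unit-v =
    GH.bounded⇒isUnit 0≤uv λ (g , h) →
      let M , bg = G.isUnit⇒bounded unit-u g
          N , bh = H.isUnit⇒bounded unit-v h
      in M ℕ.+ N , Bounded-× (G.Bounded-mono 0≤u (ℕP.m≤m+n M N) bg)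
                             (H.Bounded-mono 0≤v (ℕP.m≤n+m N M) bh)
    where
    0≤u : G.0# G.≤ u
    0≤u = G.≤ᴰ⇒≤ (proj₁ unit-u)
    0≤v : H.0# H.≤ v
    0≤v = H.≤ᴰ⇒≤ (proj₁ unit-v)
    0≤uv : GH.0# GH.≤ (u , v)
    0≤uv = 0≤u , 0≤v

  singular-× : ∀ {s t} → G.Singular s → H.Singular t → GH.Singular (s , t)
  singular-× (0≤s , disjoint-s) (0≤t , disjoint-t) =
    (0≤s , 0≤t) ,
    λ (a , b) (0≤a , 0≤b) (a≤s , b≤t) → disjoint-s a 0≤a a≤s , disjoint-t b 0≤b b≤t

-- The ℓ-group ℤ

module ℤᴸ = LGroupProperties ℤ-LGroup

≤⇒≤ᴸ : ∀ {i j} → i ℤ.≤ j → i ℤᴸ.≤ j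
≤⇒≤ᴸ i≤j = sym (ℤP.i≤j⇒i⊓j≡i i≤j)

≤ᴸ⇒≤ : ∀ {i j} → i ℤᴸ.≤ j → i ℤ.≤ j
≤ᴸ⇒≤ i≤j = ℤP.i⊓j≡i⇒i≤j (sym i≤j)

·≡* : ∀ n i → n ℤᴸ.· i ≡ + n ℤ.* i
·≡* zero    i = refl
·≡* (suc n) i = trans (cong (λ k → i ℤ.+ k) (·≡* n i)) (sym (ℤP.suc-* (+ n) i))

i≤+∣i∣ : ∀ i → i ℤ.≤ + ℤ.∣ i ∣
i≤+∣i∣ (+ n)    = ℤP.≤-refl
i≤+∣i∣ -[1+ n ] = -≤+

ℤ-isUnit : ∀ n .{{_ : NonZero n}} → ℤᴸ.IsUnit (+ n)
ℤ-isUnit n = ℤᴸ.bounded⇒isUnit {u = + n} (≤⇒≤ᴸ (+≤+ (z≤n {n})))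
               λ g → ℤ.∣ g ∣ , ℤᴸ.∣∣≤⇒Bounded (≤⇒≤ᴸ (∣g∣≤ g))
  where
  open ℤP.≤-Reasoning
  -g≤+∣g∣ : ∀ g → ℤ.- g ℤ.≤ + ℤ.∣ g ∣
  -g≤+∣g∣ g = subst (λ k → ℤ.- g ℤ.≤ + k) (ℤP.∣-i∣≡∣i∣ g) (i≤+∣i∣ (ℤ.- g))
  ∣g∣≤ : ∀ g → g ℤ.⊔ ℤ.- g ℤ.≤ ℤ.∣ g ∣ ℤᴸ.· (+ n)
  ∣g∣≤ g = begin
    g ℤ.⊔ ℤ.- g         ≤⟨ ℤP.⊔-lub (i≤+∣i∣ g) (-g≤+∣g∣ g) ⟩
    + ℤ.∣ g ∣           ≤⟨ +≤+ (ℕP.m≤m*n ℤ.∣ g ∣ n) ⟩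
    + (ℤ.∣ g ∣ ℕ.* n)   ≡⟨ ℤP.pos-* ℤ.∣ g ∣ n ⟩
    + ℤ.∣ g ∣ ℤ.* + n   ≡⟨ ·≡* ℤ.∣ g ∣ (+ n) ⟨
    ℤ.∣ g ∣ ℤᴸ.· (+ n)  ∎

ℤ[_] : (n : ℕ) → .{{_ : NonZero n}} → UnitalLGroup
ℤ[ n ] = record { group = ℤ-LGroup ; unit = + n ; isUnit = ℤ-isUnit n }

ℤ-scale-isLHom : ∀ n → IsLHom ℤ-LGroup ℤ-LGroup (+ n ℤ.*_)
ℤ-scale-isLHom n = record
  { cong  = cong (λ i → + n ℤ.* i)
  ; hom-+ = ℤP.*-distribˡ-+ (+ n)
  ; hom-∧ = λ i j → ℤP.*-distribˡ-⊓-nonNeg (+ n) i j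
  ; hom-∨ = λ i j → ℤP.*-distribˡ-⊔-nonNeg (+ n) i j
  }

lHom-ℤ-linear : ∀ {f} → IsLHom ℤ-LGroup ℤ-LGroup f → ∀ i → f i ≡ i ℤ.* f (+ 1)
lHom-ℤ-linear {f} isLHom (+ n) = begin
  f (+ n)           ≡⟨ cong f (trans (sym (ℤP.*-identityʳ (+ n))) (sym (·≡* n (+ 1)))) ⟩
  f (n ℤᴸ.· (+ 1))  ≡⟨ f-· n (+ 1) ⟩
  n ℤᴸ.· f (+ 1)    ≡⟨ ·≡* n (f (+ 1)) ⟩
  + n ℤ.* f (+ 1)   ∎
  where open IsLHomProperties isLHom; open ≡-Reasoning
lHom-ℤ-linear {f} isLHom -[1+ n ] = begin
  f (ℤ.- + suc n)            ≡⟨ f-neg (+ suc n) ⟩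
  ℤ.- f (+ suc n)            ≡⟨ cong ℤ.-_ (lHom-ℤ-linear isLHom (+ suc n)) ⟩
  ℤ.- (+ suc n ℤ.* f (+ 1))  ≡⟨ ℤP.neg-distribˡ-* (+ suc n) (f (+ 1)) ⟩
  -[1+ n ] ℤ.* f (+ 1)       ∎
  where open IsLHomProperties isLHom; open ≡-Reasoning

ℤ-singular-0 : ℤᴸ.Singular (+ 0)
ℤ-singular-0 = refl , λ { (+ 0) _ _ → refl ; (+ suc n) _ () ; -[1+ n ] () _ }

ℤ-singular-1 : ℤᴸ.Singular (+ 1)
ℤ-singular-1 = refl , λ { (+ 0) _ _ → refl ; (+ 1) _ _ → refl ; (+ suc (suc n)) _ () ; -[1+ n ] () _ }

i⊓1⊓[i-i⊓1]≡0⇒i≤1 : ∀ i → (i ℤ.⊓ + 1) ℤ.⊓ (i ℤ.- i ℤ.⊓ + 1) ≡ + 0 → i ℤ.≤ + 1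
i⊓1⊓[i-i⊓1]≡0⇒i≤1 (+ 0)           _  = +≤+ z≤n
i⊓1⊓[i-i⊓1]≡0⇒i≤1 (+ 1)           _  = +≤+ (s≤s z≤n)
i⊓1⊓[i-i⊓1]≡0⇒i≤1 (+ suc (suc n)) ()
i⊓1⊓[i-i⊓1]≡0⇒i≤1 -[1+ n ]        _  = -≤+

2*i≢1 : ∀ i → + 2 ℤ.* i ≢ + 1
2*i≢1 i 2i≡1 with ℕP.m*n≡1⇒m≡1 2 ℤ.∣ i ∣ (trans (sym (ℤP.abs-* (+ 2) i)) (cong ℤ.∣_∣ 2i≡1))
... | ()

even∩[0,1]≡0 : ∀ {i} j → i ≡ + 2 ℤ.* j → + 0 ℤ.≤ i → i ℤ.≤ + 1 → i ≡ + 0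
even∩[0,1]≡0 {+ 0}           _ _    _ _                 = refl
even∩[0,1]≡0 {+ 1}           j 1≡2j _ _                 = ⊥-elim (2*i≢1 j (sym 1≡2j))
even∩[0,1]≡0 {+ suc (suc n)} _ _    _ (+≤+ (s≤s ()))
even∩[0,1]≡0 { -[1+ n ]}     _ _    () _

disjoint-generators : ∀ {α β} x y → + 0 ℤ.≤ α → + 0 ℤ.≤ β → α ℤ.⊓ β ≡ + 0 →
                      x ℤ.* α ℤ.+ y ℤ.* β ≡ + 1 →
                      (α ≡ + 0 × β ≡ + 1) ⊎ (α ≡ + 1 × β ≡ + 0)
disjoint-generators {+ 0} {+ b} x y _ _ _ xα+yβ≡1
  rewrite ℤP.*-zeroʳ x | ℤP.+-identityˡ (y ℤ.* + b)
  with ℕP.m*n≡1⇒n≡1 ℤ.∣ y ∣ b (trans (sym (ℤP.abs-* y (+ b))) (cong ℤ.∣_∣ xα+yβ≡1))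
... | refl = inj₁ (refl , refl)
disjoint-generators {+ suc a} {+ 0} x y _ _ _ xα+yβ≡1
  rewrite ℤP.*-zeroʳ y | ℤP.+-identityʳ (x ℤ.* + suc a)
  with ℕP.m*n≡1⇒n≡1 ℤ.∣ x ∣ (suc a) (trans (sym (ℤP.abs-* x (+ suc a))) (cong ℤ.∣_∣ xα+yβ≡1))
... | refl = inj₂ (refl , refl)
disjoint-generators {+ suc a} {+ suc b} _ _ _ _ ()

-- ℤ² with unit (1,2)

ℤ² : LGroup
ℤ² = ℤ-LGroup ×ᴸ ℤ-LGroup

module ℤ²ᴸ = LGroupProperties ℤ²
open ×ᴸ-Properties ℤ-LGroup ℤ-LGroup

e₁ e₂ : ℤ × ℤ
e₁ = + 1 , + 0
e₂ = + 0 , + 1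

ℤ²⟨1,2⟩ : UnitalLGroup
ℤ²⟨1,2⟩ = record { group = ℤ² ; unit = + 1 , + 2 ; isUnit = isUnit-× (ℤ-isUnit 1) (ℤ-isUnit 2) }

basisTerms : ℕ → ℕ → List (ℤ × ℤ)
basisTerms (suc a) b       = e₁ ∷ basisTerms a b
basisTerms zero    (suc b) = e₂ ∷ basisTerms zero b
basisTerms zero    zero    = []

basisTerms-singular : ∀ a b → All ℤ²ᴸ.Singular (basisTerms a b)
basisTerms-singular (suc a) b       = singular-× ℤ-singular-1 ℤ-singular-0 ∷ basisTerms-singular a b
basisTerms-singular zero    (suc b) = singular-× ℤ-singular-0 ℤ-singular-1 ∷ basisTerms-singular zero b
basisTerms-singular zero    zero    = []

sum-basisTerms : ∀ a b → ℤ²ᴸ.sum (basisTerms a b) ≡ (+ a , + b)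
sum-basisTerms (suc a) b       rewrite sum-basisTerms a b    = refl
sum-basisTerms zero    (suc b) rewrite sum-basisTerms zero b = refl
sum-basisTerms zero    zero    = refl

difference-of-naturals : ∀ i → ∃₂ λ a b → i ≡ + a ℤ.- + b
difference-of-naturals (+ a)    = a , 0 , sym (ℤP.+-identityʳ (+ a))
difference-of-naturals -[1+ b ] = 0 , suc b , refl

ℤ²-isSpecker : IsUnitalSpecker ℤ²⟨1,2⟩
ℤ²-isSpecker (x , y) =
  let a₁ , b₁ , x≡ = difference-of-naturals x
      a₂ , b₂ , y≡ = difference-of-naturals y
  in basisTerms a₁ a₂ , basisTerms b₁ b₂ , basisTerms-singular a₁ a₂ , basisTerms-singular b₁ b₂ ,
     subst₂ (λ p q → (x , y) ℤ²ᴸ.≈ p ℤ²ᴸ.- q) (sym (sum-basisTerms a₁ a₂)) (sym (sum-basisTerms b₁ b₂)) (x≡ , y≡)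

lHom-ℤ²-linear : ∀ {ρ} → IsLHom ℤ² ℤ-LGroup ρ → ∀ x y → ρ (x , y) ≡ x ℤ.* ρ e₁ ℤ.+ y ℤ.* ρ e₂
lHom-ℤ²-linear {ρ} isLHom x y = begin
  ρ (x , y)                        ≡⟨ cong ρ (cong₂ _,_ (sym (ℤP.+-identityʳ x)) (sym (ℤP.+-identityˡ y))) ⟩
  ρ ((x , + 0) ℤ²ᴸ.+ (+ 0 , y))    ≡⟨ hom-+ (x , + 0) (+ 0 , y) ⟩
  ρ (x , + 0) ℤ.+ ρ (+ 0 , y)      ≡⟨ cong₂ ℤ._+_ (lHom-ℤ-linear (∘-isLHom isLHom inj₁-isLHom) x)
                                                   (lHom-ℤ-linear (∘-isLHom isLHom inj₂-isLHom) y) ⟩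
  x ℤ.* ρ e₁ ℤ.+ y ℤ.* ρ e₂        ∎
  where open IsLHom isLHom using (hom-+); open ≡-Reasoning

surjective-lHom-ℤ²-on-basis : ∀ {ρ} → IsLHom ℤ² ℤ-LGroup ρ → (∀ z → ∃ λ g → ρ g ≡ z) →
                           (ρ e₁ ≡ + 0 × ρ e₂ ≡ + 1) ⊎ (ρ e₁ ≡ + 1 × ρ e₂ ≡ + 0)
surjective-lHom-ℤ²-on-basis {ρ} isLHom surjective =
  let (x , y) , ρxy≡1 = surjective (+ 1) in
  disjoint-generators x y (0≤ρ e₁ (refl , refl)) (0≤ρ e₂ (refl , refl))
                      (trans (sym (hom-∧ e₁ e₂)) f-0#) (trans (sym (lHom-ℤ²-linear isLHom x y)) ρxy≡1)
  where
  open IsLHom isLHom using (hom-∧)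
  open IsLHomProperties isLHom
  0≤ρ : ∀ e → ℤ²ᴸ.0# ℤ²ᴸ.≤ e → + 0 ℤ.≤ ρ e
  0≤ρ e 0≤e = subst (ℤ._≤ ρ e) f-0# (≤ᴸ⇒≤ (f-mono 0≤e))

ℤ²⟨1,2⟩-u♮≤2 : UNaturalBoundedBy ℤ²⟨1,2⟩ 2
ℤ²⟨1,2⟩-u♮≤2 _ _ ρ isLHom surjective _
  rewrite lHom-ℤ²-linear isLHom (+ 1) (+ 2)
  with surjective-lHom-ℤ²-on-basis isLHom surjective
... | inj₁ (ρe₁≡0 , ρe₂≡1) rewrite ρe₁≡0 | ρe₂≡1 = ℤP.≤-refl
... | inj₂ (ρe₁≡1 , ρe₂≡0) rewrite ρe₁≡1 | ρe₂≡0 = +≤+ (s≤s z≤n)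

-- Coproducts of unital ℓ-groups, presented by generators and relations

module FreeCoproduct {I : Set} (S : I → UnitalLGroup) (i₀ : I) where
  private
    module S (i : I) = LGroupProperties (UnitalLGroup.group (S i))
    u : (i : I) → S.Carrier i
    u i = UnitalLGroup.unit (S i)

  infixl 6 _+ᵗ_
  infixr 6 _∨ᵗ_
  infixr 7 _∧ᵗ_
  data Term : Set where
    gen  : (i : I) → S.Carrier i → Term
    0ᵗ   : Term
    _+ᵗ_ : Term → Term → Term
    -ᵗ_  : Term → Term
    _∨ᵗ_ : Term → Term → Term
    _∧ᵗ_ : Term → Term → Term

  infix 4 _≈ᵗ_
  data _≈ᵗ_ : Term → Term → Set where
    ≈-refl      : ∀ {a} → a ≈ᵗ a
    ≈-sym       : ∀ {a b} → a ≈ᵗ b → b ≈ᵗ a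
    ≈-trans     : ∀ {a b c} → a ≈ᵗ b → b ≈ᵗ c → a ≈ᵗ c
    +-cong      : ∀ {a a′ b b′} → a ≈ᵗ a′ → b ≈ᵗ b′ → a +ᵗ b ≈ᵗ a′ +ᵗ b′
    neg-cong    : ∀ {a a′} → a ≈ᵗ a′ → -ᵗ a ≈ᵗ -ᵗ a′
    ∨-cong      : ∀ {a a′ b b′} → a ≈ᵗ a′ → b ≈ᵗ b′ → a ∨ᵗ b ≈ᵗ a′ ∨ᵗ b′
    ∧-cong      : ∀ {a a′ b b′} → a ≈ᵗ a′ → b ≈ᵗ b′ → a ∧ᵗ b ≈ᵗ a′ ∧ᵗ b′
    +-assoc     : ∀ a b c → (a +ᵗ b) +ᵗ c ≈ᵗ a +ᵗ (b +ᵗ c)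
    +-identityˡ : ∀ a → 0ᵗ +ᵗ a ≈ᵗ a
    +-identityʳ : ∀ a → a +ᵗ 0ᵗ ≈ᵗ a
    -‿inverseˡ  : ∀ a → (-ᵗ a) +ᵗ a ≈ᵗ 0ᵗ
    -‿inverseʳ  : ∀ a → a +ᵗ (-ᵗ a) ≈ᵗ 0ᵗ
    +-comm      : ∀ a b → a +ᵗ b ≈ᵗ b +ᵗ a
    ∨-comm      : ∀ a b → a ∨ᵗ b ≈ᵗ b ∨ᵗ a
    ∨-assoc     : ∀ a b c → (a ∨ᵗ b) ∨ᵗ c ≈ᵗ a ∨ᵗ (b ∨ᵗ c)
    ∧-comm      : ∀ a b → a ∧ᵗ b ≈ᵗ b ∧ᵗ a
    ∧-assoc     : ∀ a b c → (a ∧ᵗ b) ∧ᵗ c ≈ᵗ a ∧ᵗ (b ∧ᵗ c)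
    ∨-absorbs-∧ : ∀ a b → a ∨ᵗ (a ∧ᵗ b) ≈ᵗ a
    ∧-absorbs-∨ : ∀ a b → a ∧ᵗ (a ∨ᵗ b) ≈ᵗ a
    +-distrib-∨ : ∀ a b c → (a ∨ᵗ b) +ᵗ c ≈ᵗ (a +ᵗ c) ∨ᵗ (b +ᵗ c)
    gen-cong    : ∀ i {p q} → S._≈_ i p q → gen i p ≈ᵗ gen i q
    gen-+       : ∀ i p q → gen i (S._+_ i p q) ≈ᵗ gen i p +ᵗ gen i q
    gen-∨       : ∀ i p q → gen i (S._∨_ i p q) ≈ᵗ gen i p ∨ᵗ gen i q
    gen-∧       : ∀ i p q → gen i (S._∧_ i p q) ≈ᵗ gen i p ∧ᵗ gen i q
    gen-unit    : ∀ i → gen i (u i) ≈ᵗ gen i₀ (u i₀)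

  termLGroup : LGroup
  termLGroup = record
    { Carrier        = Term
    ; _≈_            = _≈ᵗ_
    ; _+_            = _+ᵗ_
    ; 0#             = 0ᵗ
    ; -_             = -ᵗ_
    ; _∨_            = _∨ᵗ_
    ; _∧_            = _∧ᵗ_
    ; isAbelianGroup = record
      { isGroup = record
        { isMonoid = record
          { isSemigroup = record
            { isMagma = record { isEquivalence = isEquivalence ; ∙-cong = +-cong }
            ; assoc   = +-assoc
            }
          ; identity = +-identityˡ , +-identityʳ
          }
        ; inverse = -‿inverseˡ , -‿inverseʳ
        ; ⁻¹-cong = neg-cong
        }
      ; comm = +-comm
      }
    ; isLattice      = record
      { isEquivalence = isEquivalence
      ; ∨-comm        = ∨-comm
      ; ∨-assoc       = ∨-assoc
      ; ∨-cong        = ∨-cong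
      ; ∧-comm        = ∧-comm
      ; ∧-assoc       = ∧-assoc
      ; ∧-cong        = ∧-cong
      ; absorptive    = ∨-absorbs-∧ , ∧-absorbs-∨
      }
    ; +-distrib-∨    = +-distrib-∨
    }
    where
    isEquivalence : IsEquivalence _≈ᵗ_
    isEquivalence = record { refl = ≈-refl ; sym = ≈-sym ; trans = ≈-trans }

  private
    module T = LGroupProperties termLGroup

  gen-isLHom : ∀ i → IsLHom (UnitalLGroup.group (S i)) termLGroup (gen i)
  gen-isLHom i = record { cong = gen-cong i ; hom-+ = gen-+ i ; hom-∧ = gen-∧ i ; hom-∨ = gen-∨ i }

  uᵗ : Term
  uᵗ = gen i₀ (u i₀)

  0≤uᵗ : 0ᵗ T.≤ uᵗ
  0≤uᵗ = T.≤-respˡ-≈ f-0# (f-mono (S.≤ᴰ⇒≤ i₀ (proj₁ (UnitalLGroup.isUnit (S i₀)))))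
    where open IsLHomProperties (gen-isLHom i₀)

  gen-Bounded : ∀ i p → ∃ λ N → T.Bounded uᵗ N (gen i p)
  gen-Bounded i p =
    let N , bp = S.isUnit⇒bounded i (UnitalLGroup.isUnit (S i)) p in
    N , T.Bounded-unit-cong (gen-unit i) (IsLHomProperties.f-Bounded (gen-isLHom i) bp)

  term-Bounded : ∀ t → ∃ λ N → T.Bounded uᵗ N t
  term-Bounded (gen i p) = gen-Bounded i p
  term-Bounded 0ᵗ        = 0 , T.Bounded-0# 0≤uᵗ
  term-Bounded (a +ᵗ b)  = let M , ba = term-Bounded a ; N , bb = term-Bounded b in
                           M ℕ.+ N , T.Bounded-+ 0≤uᵗ ba bb
  term-Bounded (-ᵗ a)    = let M , ba = term-Bounded a in M , T.Bounded-neg ba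
  term-Bounded (a ∨ᵗ b)  = let M , ba = term-Bounded a ; N , bb = term-Bounded b in
                           M ℕ.+ N , T.Bounded-∨ 0≤uᵗ ba bb
  term-Bounded (a ∧ᵗ b)  = let M , ba = term-Bounded a ; N , bb = term-Bounded b in
                           M ℕ.+ N , T.Bounded-∧ 0≤uᵗ ba bb

  C : UnitalLGroup
  C = record { group = termLGroup ; unit = uᵗ ; isUnit = T.bounded⇒isUnit 0≤uᵗ term-Bounded }

  ι : ∀ i → UHom (S i) C
  ι i = record { fun = gen i ; isLHom = gen-isLHom i ; unital = gen-unit i }

  module Evaluation {H : UnitalLGroup} (f : ∀ i → UHom (S i) H) where
    private
      module H = LGroupProperties (UnitalLGroup.group H)
      module f i = IsLHom (UHom.isLHom (f i))

    evaluate : Term → H.Carrier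
    evaluate (gen i p) = UHom.fun (f i) p
    evaluate 0ᵗ        = H.0#
    evaluate (a +ᵗ b)  = evaluate a H.+ evaluate b
    evaluate (-ᵗ a)    = H.- evaluate a
    evaluate (a ∨ᵗ b)  = evaluate a H.∨ evaluate b
    evaluate (a ∧ᵗ b)  = evaluate a H.∧ evaluate b

    evaluate-cong : ∀ {a b} → a ≈ᵗ b → evaluate a H.≈ evaluate b
    evaluate-cong ≈-refl              = H.≈-refl
    evaluate-cong (≈-sym p)           = H.≈-sym (evaluate-cong p)
    evaluate-cong (≈-trans p q)       = H.≈-trans (evaluate-cong p) (evaluate-cong q)
    evaluate-cong (+-cong p q)        = H.∙-cong (evaluate-cong p) (evaluate-cong q)
    evaluate-cong (neg-cong p)        = H.⁻¹-cong (evaluate-cong p)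
    evaluate-cong (∨-cong p q)        = H.∨-cong (evaluate-cong p) (evaluate-cong q)
    evaluate-cong (∧-cong p q)        = H.∧-cong (evaluate-cong p) (evaluate-cong q)
    evaluate-cong (+-assoc a b c)     = H.assoc _ _ _
    evaluate-cong (+-identityˡ a)     = H.identityˡ _
    evaluate-cong (+-identityʳ a)     = H.identityʳ _
    evaluate-cong (-‿inverseˡ a)      = H.inverseˡ _
    evaluate-cong (-‿inverseʳ a)      = H.inverseʳ _
    evaluate-cong (+-comm a b)        = H.comm _ _
    evaluate-cong (∨-comm a b)        = H.∨-comm _ _
    evaluate-cong (∨-assoc a b c)     = H.∨-assoc _ _ _
    evaluate-cong (∧-comm a b)        = H.∧-comm _ _
    evaluate-cong (∧-assoc a b c)     = H.∧-assoc _ _ _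
    evaluate-cong (∨-absorbs-∧ a b)   = H.∨-absorbs-∧ _ _
    evaluate-cong (∧-absorbs-∨ a b)   = H.∧-absorbs-∨ _ _
    evaluate-cong (+-distrib-∨ a b c) = H.+-distrib-∨ _ _ _
    evaluate-cong (gen-cong i p)      = f.cong i p
    evaluate-cong (gen-+ i p q)       = f.hom-+ i p q
    evaluate-cong (gen-∨ i p q)       = f.hom-∨ i p q
    evaluate-cong (gen-∧ i p q)       = f.hom-∧ i p q
    evaluate-cong (gen-unit i)        = H.≈-trans (UHom.unital (f i)) (H.≈-sym (UHom.unital (f i₀)))

    mediator : UHom C H
    mediator = record
      { fun    = evaluate
      ; isLHom = record
        { cong  = evaluate-cong
        ; hom-+ = λ _ _ → H.≈-refl
        ; hom-∧ = λ _ _ → H.≈-refl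
        ; hom-∨ = λ _ _ → H.≈-refl
        }
      ; unital = UHom.unital (f i₀)
      }

  open Evaluation public using (evaluate; evaluate-cong; mediator)

  unique-on-generators : ∀ {H} (h h′ : UHom C H) →
                         (∀ i p → UnitalLGroup._≈_ H (UHom.fun h (gen i p)) (UHom.fun h′ (gen i p))) →
                         h ≗U h′
  unique-on-generators {H} h h′ agree = go
    where
    module H = LGroupProperties (UnitalLGroup.group H)
    module h = IsLHom (UHom.isLHom h)
    module h′ = IsLHom (UHom.isLHom h′)
    module hᴾ = IsLHomProperties (UHom.isLHom h)
    module h′ᴾ = IsLHomProperties (UHom.isLHom h′)
    go : ∀ t → UHom.fun h t H.≈ UHom.fun h′ t
    go (gen i p) = agree i p
    go 0ᵗ        = H.≈-trans hᴾ.f-0# (H.≈-sym h′ᴾ.f-0#)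
    go (a +ᵗ b)  = H.≈-trans (h.hom-+ a b) (H.≈-trans (H.∙-cong (go a) (go b)) (H.≈-sym (h′.hom-+ a b)))
    go (-ᵗ a)    = H.≈-trans (hᴾ.f-neg a) (H.≈-trans (H.⁻¹-cong (go a)) (H.≈-sym (h′ᴾ.f-neg a)))
    go (a ∨ᵗ b)  = H.≈-trans (h.hom-∨ a b) (H.≈-trans (H.∨-cong (go a) (go b)) (H.≈-sym (h′.hom-∨ a b)))
    go (a ∧ᵗ b)  = H.≈-trans (h.hom-∧ a b) (H.≈-trans (H.∧-cong (go a) (go b)) (H.≈-sym (h′.hom-∧ a b)))

  isCoproduct : IsCoproduct S C ι
  isCoproduct = record
    { mediate = λ H f → mediator f , λ _ _ → LGroupProperties.≈-refl (UnitalLGroup.group H)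
    ; unique  = λ H → unique-on-generators
    }

  indices : Term → List I
  indices (gen i p) = i ∷ []
  indices 0ᵗ        = []
  indices (a +ᵗ b)  = indices a ++ indices b
  indices (-ᵗ a)    = indices a
  indices (a ∨ᵗ b)  = indices a ++ indices b
  indices (a ∧ᵗ b)  = indices a ++ indices b

  evaluate-local : ∀ {H} (f g : ∀ i → UHom (S i) H) t → All (λ i → f i ≗U g i) (indices t) →
                   UnitalLGroup._≈_ H (evaluate f t) (evaluate g t)
  evaluate-local {H} f g = go
    where
    module H = LGroupProperties (UnitalLGroup.group H)
    go : ∀ t → All (λ i → f i ≗U g i) (indices t) → evaluate f t H.≈ evaluate g t
    go (gen i p) (fᵢ≗gᵢ ∷ []) = fᵢ≗gᵢ p
    go 0ᵗ        _             = H.≈-refl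
    go (a +ᵗ b)  agree = let aa , ab = Allₚ.++⁻ (indices a) agree in H.∙-cong (go a aa) (go b ab)
    go (-ᵗ a)    agree = H.⁻¹-cong (go a agree)
    go (a ∨ᵗ b)  agree = let aa , ab = Allₚ.++⁻ (indices a) agree in H.∨-cong (go a aa) (go b ab)
    go (a ∧ᵗ b)  agree = let aa , ab = Allₚ.++⁻ (indices a) agree in H.∧-cong (go a aa) (go b ab)

-- The coproduct of countably many copies of ℤ²⟨1,2⟩

open FreeCoproduct (λ (_ : ℕ) → ℤ²⟨1,2⟩) 0

module Cᴸ = LGroupProperties termLGroup

first : UHom ℤ²⟨1,2⟩ ℤ[ 1 ]
first = record { fun = proj₁ ; isLHom = proj₁-isLHom ; unital = refl }

second : UHom ℤ²⟨1,2⟩ ℤ[ 2 ]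
second = record { fun = proj₂ ; isLHom = proj₂-isLHom ; unital = refl }

doubling : UHom ℤ[ 1 ] ℤ[ 2 ]
doubling = record { fun = + 2 ℤ.*_ ; isLHom = ℤ-scale-isLHom 2 ; unital = refl }

doubledFirst : UHom ℤ²⟨1,2⟩ ℤ[ 2 ]
doubledFirst = doubling ∘ᵘ first

secondAt : ℕ → ℕ → UHom ℤ²⟨1,2⟩ ℤ[ 2 ]
secondAt k i with i ℕ.≟ k
... | yes _ = second
... | no  _ = doubledFirst

secondAt-≢ : ∀ {k i} → i ≢ k → secondAt k i ≡ doubledFirst
secondAt-≢ {k} {i} i≢k with i ℕ.≟ k
... | yes i≡k = ⊥-elim (i≢k i≡k)
... | no  _   = refl

secondAt-self : ∀ k → secondAt k k ≡ second
secondAt-self k with k ℕ.≟ k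
... | yes _   = refl
... | no  k≢k = ⊥-elim (k≢k refl)

fresh : (xs : List ℕ) → ∃ λ k → All (_≢ k) xs
fresh xs = suc (max 0 xs) , All.map (λ i≤max → ℕP.<⇒≢ (s≤s i≤max)) (xs≤max 0 xs)

doubled : Term → ℤ
doubled = evaluate (λ _ → doubledFirst)

doubled-even : ∀ t → doubled t ≡ + 2 ℤ.* evaluate (λ _ → first) t
doubled-even = unique-on-generators (mediator (λ _ → doubledFirst))
                                    (doubling ∘ᵘ mediator (λ _ → first)) (λ _ _ → refl)

doubled-nonneg : ∀ {t} → 0ᵗ Cᴸ.≤ t → + 0 ℤ.≤ doubled t
doubled-nonneg 0≤t = ≤ᴸ⇒≤ (IsLHomProperties.f-mono (UHom.isLHom (mediator (λ _ → doubledFirst))) 0≤t)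

secondAt-fresh : ∀ t → ∃ λ k → evaluate (secondAt k) t ≡ doubled t
secondAt-fresh t =
  let k , k-fresh = fresh (indices t) in
  k , evaluate-local (secondAt k) (λ _ → doubledFirst) t (All.map agree k-fresh)
  where
  agree : ∀ {k i} → i ≢ k → secondAt k i ≗U doubledFirst
  agree i≢k p rewrite secondAt-≢ i≢k = refl

secondAt-singular≤1 : ∀ k {s} → Cᴸ.Singular s → evaluate (secondAt k) s ℤ.≤ + 1
secondAt-singular≤1 k {s} (0≤s , disjoint) = i⊓1⊓[i-i⊓1]≡0⇒i≤1 w disjoint-image
  where
  w : ℤ
  w = evaluate (secondAt k) s

  a : Term
  a = s ∧ᵗ gen k e₂

  0≤a : 0ᵗ Cᴸ.≤ a
  0≤a = Cᴸ.∧-greatest (Cᴸ.≤ᴰ⇒≤ 0≤s) (Cᴸ.≤-respˡ-≈ f-0# (f-mono {a = ℤ²ᴸ.0#} {b = e₂} (refl , refl)))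
    where open IsLHomProperties (gen-isLHom k)

  disjoint-image : (w ℤ.⊓ + 1) ℤ.⊓ (w ℤ.- w ℤ.⊓ + 1) ≡ + 0
  disjoint-image =
    subst (λ e → (w ℤ.⊓ e) ℤ.⊓ (w ℤ.- w ℤ.⊓ e) ≡ + 0) (cong (λ f → UHom.fun f e₂) (secondAt-self k))
      (evaluate-cong (secondAt k) (disjoint a (Cᴸ.≤⇒≤ᴰ 0≤a) (Cᴸ.≤⇒≤ᴰ (Cᴸ.x∧y≤x s (gen k e₂)))))

doubled-singular≡0 : ∀ {s} → Cᴸ.Singular s → doubled s ≡ + 0
doubled-singular≡0 {s} s-singular@(0≤s , _) =
  let k , secondAt≡doubled = secondAt-fresh s in
  even∩[0,1]≡0 _ (doubled-even s) (doubled-nonneg (Cᴸ.≤ᴰ⇒≤ 0≤s))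
               (subst (ℤ._≤ + 1) secondAt≡doubled (secondAt-singular≤1 k s-singular))

doubled-sum≡0 : ∀ {ss} → All Cᴸ.Singular ss → doubled (Cᴸ.sum ss) ≡ + 0
doubled-sum≡0 []                       = refl
doubled-sum≡0 (s-singular ∷ ss-singular) =
  cong₂ ℤ._+_ (doubled-singular≡0 s-singular) (doubled-sum≡0 ss-singular)

C-not-Specker : ¬ IsUnitalSpecker C
C-not-Specker specker =
  let ss , ts , ss-singular , ts-singular , uᵗ≈ss-ts = specker uᵗ in
  2≢0 (trans (evaluate-cong (λ _ → doubledFirst) uᵗ≈ss-ts)
             (cong₂ ℤ._-_ (doubled-sum≡0 ss-singular) (doubled-sum≡0 ts-singular)))
  where
  2≢0 : + 2 ≢ + 0
  2≢0 ()

proposition8p3 :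
    Σ Set λ I → (ℕ ↣ I) ×
    Σ (I → UnitalLGroup) λ S → (∀ i → IsUnitalSpecker (S i)) ×
    Σ ℕ λ n → (1 ℕ.≤ n) × (∀ i → UNaturalBoundedBy (S i) n) ×
    Σ UnitalLGroup λ C → Σ (∀ i → UHom (S i) C) λ ι →
      IsCoproduct S C ι × ¬ IsUnitalSpecker C
proposition8p3 =
  ℕ , ↣-id ℕ , (λ _ → ℤ²⟨1,2⟩) , (λ _ → ℤ²-isSpecker) , 2 , s≤s z≤n , (λ _ → ℤ²⟨1,2⟩-u♮≤2) ,
  C , ι , isCoproduct , C-not-Specker
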